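{- For every integer $m\geq 1$, the star $K_{1,m}$ has a unique distance-balanced closure (up to isomorphism), namely the complete graph $K_{m+1}$. Consequently $b(K_{1,m})=\binom{m+1}{2}-m$.
   Context: All graphs are finite and simple. For vertices $u,v$ of a graph $G$, $d_G(u,v)$ denotes the length of a shortest $u$–$v$ path. For an edge $xy$ of $G$, $W^G_{xy}=\{u\in V(G): d_G(u,x)<d_G(u,y)\}$. A graph $G$ is distance-balanced if $|W^G_{xy}|=|W^G_{yx}|$ for every edge $xy$ of $G$. For a graph $H$, $b(H)$ is the smallest number of edges which can be added to $H$ (keeping the vertex set) so that the resulting graph is distance-balanced. A graph $G$ is a distance-balanced closure of $H$ if $G$ is distance-balanced, $H$ is a spanning subgraph of $G$, and $|E(G)|=|E(H)|+b(H)$. -}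

module Defs where

open import Data.Nat using (ℕ; zero; suc; _+_; _≤_; _<ᵇ_)
open import Data.Bool using (Bool; true; false; _∧_; _∨_; not; if_then_else_)
open import Data.Fin using (Fin; zero; suc; toℕ; _≟_)
open import Relation.Nullary.Decidable using (isYes)
open import Relation.Binary.PropositionalEquality using (_≡_; refl; sym)
open import Relation.Nullary using (yes; no)
open import Data.Empty using (⊥-elim)
open import Data.Product using (Σ; _×_)
open import Function.Bundles using (_↔_; Inverse)

record Graph (n : ℕ) : Set where
  field
    adj   : Fin n → Fin n → Bool
    adj-sym : ∀ i j → adj i j ≡ adj j i
    adj-irr : ∀ i → adj i i ≡ false
open Graph public

sumFin : ∀ {n} → (Fin n → ℕ) → ℕ
sumFin {zero}  f = 0
sumFin {suc n} f = f zero + sumFin (λ i → f (suc i))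

anyFin : ∀ {n} → (Fin n → Bool) → Bool
anyFin {zero}  f = false
anyFin {suc n} f = f zero ∨ anyFin (λ i → f (suc i))

anyUpTo : ℕ → (ℕ → Bool) → Bool
anyUpTo zero    p = p 0
anyUpTo (suc N) p = anyUpTo N p ∨ p (suc N)

count : ∀ {n} → (Fin n → Bool) → ℕ
count f = sumFin (λ i → if f i then 1 else 0)

-- within G k u v = true  iff  d_G(u,v) ≤ k  (there is a u–v walk of length ≤ k).
within : ∀ {n} → Graph n → ℕ → Fin n → Fin n → Bool
within G zero    u v = isYes (u ≟ v)
within G (suc k) u v = within G k u v ∨ anyFin (λ w → within G k u w ∧ adj G w v)

-- closer G u x y = true  iff  d_G(u,x) < d_G(u,y)   (d = ∞ between components):
-- there is k with d(u,x) ≤ k < d(u,y); since finite distances are < n, k ≤ n suffices.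
closer : ∀ {n} → Graph n → Fin n → Fin n → Fin n → Bool
closer {n} G u x y = anyUpTo n (λ k → within G k u x ∧ not (within G k u y))

W : ∀ {n} → Graph n → Fin n → Fin n → ℕ
W G x y = count (λ u → closer G u x y)

DistanceBalanced : ∀ {n} → Graph n → Set
DistanceBalanced G = ∀ x y → adj G x y ≡ true → W G x y ≡ W G y x

edges : ∀ {n} → Graph n → ℕ
edges G = sumFin (λ i → count (λ j → adj G i j ∧ (toℕ i <ᵇ toℕ j)))

_⊆G_ : ∀ {n} → Graph n → Graph n → Set
H ⊆G G = ∀ i j → adj H i j ≡ true → adj G i j ≡ true

IsB : ∀ {n} → Graph n → ℕ → Set
IsB H k =
  Σ (Graph _) (λ G → DistanceBalanced G × H ⊆G G × edges G ≡ edges H + k)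
  × (∀ G → DistanceBalanced G → H ⊆G G → edges H + k ≤ edges G)

IsDBClosure : ∀ {n} → Graph n → Graph n → Set
IsDBClosure H G = DistanceBalanced G × H ⊆G G × (∀ k → IsB H k → edges G ≡ edges H + k)

_≅_ : ∀ {n} → Graph n → Graph n → Set
_≅_ {n} G K = Σ (Fin n ↔ Fin n) (λ f → ∀ i j → adj G i j ≡ adj K (Inverse.to f i) (Inverse.to f j))

complete : (n : ℕ) → Graph n
complete n = record { adj = λ i j → not (isYes (i ≟ j)) ; adj-sym = symC ; adj-irr = irrC }
  where
  symC : ∀ i j → not (isYes (i ≟ j)) ≡ not (isYes (j ≟ i))
  symC i j with i ≟ j | j ≟ i
  ... | yes _ | yes _ = refl
  ... | no _  | no _  = refl
  ... | yes p | no q  = ⊥-elim (q (sym p))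
  ... | no p  | yes q = ⊥-elim (p (sym q))
  irrC : ∀ i → not (isYes (i ≟ i)) ≡ false
  irrC i with i ≟ i
  ... | yes _ = refl
  ... | no ¬p = ⊥-elim (¬p refl)

isCentre : ∀ {m} → Fin (suc m) → Bool
isCentre zero    = true
isCentre (suc _) = false

star : (m : ℕ) → Graph (suc m)
star m = record { adj = λ i j → isCentre i xor' isCentre j ; adj-sym = symS ; adj-irr = irrS }
  where
  _xor'_ : Bool → Bool → Bool
  true  xor' b = not b
  false xor' b = b
  symS : ∀ (i j : Fin (suc m)) → (isCentre i xor' isCentre j) ≡ (isCentre j xor' isCentre i)
  symS zero zero = refl
  symS zero (suc j) = refl
  symS (suc i) zero = refl
  symS (suc i) (suc j) = refl
  irrS : ∀ (i : Fin (suc m)) → (isCentre i xor' isCentre i) ≡ false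
  irrS zero = refl
  irrS (suc i) = refl

-- If G is a distance-balanced supergraph of K_{1,m}, the centre c is adjacent to every
-- vertex, so every vertex is within distance 1 of c and W_{xc} = {x} for a leaf x.
-- Balance forces |W_{cx}| = 1 as well; but W_{cx} contains c and every leaf that is not
-- adjacent to x. Hence G is complete, and K_{m+1} is distance-balanced since
-- W_{xy} = {x} for every edge xy.
module Submission where

open import Defs
open import Data.Nat using (ℕ; zero; suc; _+_; _≤_; _>_; _∸_; _<ᵇ_; z≤n; s≤s)
open import Data.Nat.Properties
  using (≤-trans; ≤-reflexive; ≤-antisym; >⇒≢; m≤n+m; +-identityʳ; m+n∸m≡n; m≤n⇒m<n∨m≡n)
open import Data.Nat.Combinatorics using (_C_; nC1≡n; nCk+nC[k+1]≡[n+1]C[k+1])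
open import Data.Fin using (Fin; zero; suc; toℕ; _≟_)
open import Data.Fin.Properties using (suc-injective; toℕ<n; 0≢1+n)
open import Data.Bool using (Bool; true; false; _∧_; _∨_; not; if_then_else_)
open import Data.Bool.Properties using (¬-not; not-¬)
open import Data.Empty using (⊥-elim)
open import Data.Product using (∃; _×_; _,_)
open import Data.Sum using (_⊎_; inj₁; inj₂)
open import Function.Properties.Inverse using (↔-refl)
open import Relation.Nullary using (yes; no)
open import Relation.Nullary.Decidable using (isYes; isYes≗does; dec-true; dec-false; toSum)
open import Relation.Binary.PropositionalEquality
  using (_≡_; _≢_; refl; sym; trans; cong; cong₂; subst; ≢-sym; module ≡-Reasoning)

∨-trueˡ : ∀ {a b} → a ≡ true → a ∨ b ≡ true
∨-trueˡ refl = refl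

∨-trueʳ : ∀ a {b} → b ≡ true → a ∨ b ≡ true
∨-trueʳ true  _ = refl
∨-trueʳ false e = e

∨-true⇒⊎ : ∀ a {b} → a ∨ b ≡ true → a ≡ true ⊎ b ≡ true
∨-true⇒⊎ true  _ = inj₁ refl
∨-true⇒⊎ false e = inj₂ e

∧-true⇒× : ∀ a {b} → a ∧ b ≡ true → a ≡ true × b ≡ true
∧-true⇒× true e = refl , e

×⇒∧-true : ∀ {a b} → a ≡ true → b ≡ true → a ∧ b ≡ true
×⇒∧-true refl refl = refl

not-true⇒false : ∀ {a} → not a ≡ true → a ≡ false
not-true⇒false {false} _ = refl

isYes-≟-refl : ∀ {n} (u : Fin n) → isYes (u ≟ u) ≡ true
isYes-≟-refl u = trans (isYes≗does (u ≟ u)) (dec-true (u ≟ u) refl)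

isYes-≟-≢ : ∀ {n} {u v : Fin n} → u ≢ v → isYes (u ≟ v) ≡ false
isYes-≟-≢ {u = u} {v} u≢v = trans (isYes≗does (u ≟ v)) (dec-false (u ≟ v) u≢v)

isYes-≟⇒≡ : ∀ {n} (u v : Fin n) → isYes (u ≟ v) ≡ true → u ≡ v
isYes-≟⇒≡ u v e with u ≟ v
... | yes u≡v = u≡v

isYes-suc-≟-suc : ∀ {n} (u v : Fin n) → isYes (suc u ≟ suc v) ≡ isYes (u ≟ v)
isYes-suc-≟-suc u v with u ≟ v
... | yes _ = refl
... | no  _ = refl

sumFin-cong : ∀ {n} {f g : Fin n → ℕ} → (∀ i → f i ≡ g i) → sumFin f ≡ sumFin g
sumFin-cong {zero}  e = refl
sumFin-cong {suc n} e = cong₂ _+_ (e zero) (sumFin-cong (λ i → e (suc i)))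

count-cong : ∀ {n} {f g : Fin n → Bool} → (∀ i → f i ≡ g i) → count f ≡ count g
count-cong e = sumFin-cong (λ i → cong (λ b → if b then 1 else 0) (e i))

sumFin-const-zero : ∀ {n} {f : Fin n → ℕ} → (∀ i → f i ≡ 0) → sumFin f ≡ 0
sumFin-const-zero {zero}  e = refl
sumFin-const-zero {suc n} e rewrite e zero = sumFin-const-zero (λ i → e (suc i))

count-const-false : ∀ {n} (f : Fin n → Bool) → (∀ i → f i ≡ false) → count f ≡ 0
count-const-false f e = sumFin-const-zero (λ i → cong (λ b → if b then 1 else 0) (e i))

count-const-true : ∀ {n} (f : Fin n → Bool) → (∀ i → f i ≡ true) → count f ≡ n
count-const-true {zero}  f e = refl
count-const-true {suc n} f e rewrite e zero =
  cong suc (count-const-true (λ i → f (suc i)) (λ i → e (suc i)))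

count-≤1 : ∀ {n} (f : Fin n → Bool) (v : Fin n) → (∀ u → f u ≡ true → u ≡ v) → count f ≤ 1
count-≤1 {suc n} f zero only-zero
  rewrite count-const-false (λ i → f (suc i)) (λ i → ¬-not (λ e → 0≢1+n (sym (only-zero (suc i) e))))
        | +-identityʳ (if f zero then 1 else 0)
  with f zero
... | true  = s≤s z≤n
... | false = z≤n
count-≤1 {suc n} f (suc v) only-v
  rewrite ¬-not {f zero} {true} (λ e → 0≢1+n (only-v zero e)) =
  count-≤1 (λ i → f (suc i)) v (λ u e → suc-injective (only-v (suc u) e))

count-≥1 : ∀ {n} (f : Fin n → Bool) (a : Fin n) → f a ≡ true → 1 ≤ count f
count-≥1 f zero    e rewrite e = s≤s z≤n
count-≥1 f (suc a) e = ≤-trans (count-≥1 (λ i → f (suc i)) a e) (m≤n+m _ _)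

count-≥2 : ∀ {n} (f : Fin n → Bool) {a b : Fin n} →
           f a ≡ true → f b ≡ true → a ≢ b → 2 ≤ count f
count-≥2 f {zero}  {zero}  _  _  a≢b = ⊥-elim (a≢b refl)
count-≥2 f {zero}  {suc b} ea eb _   rewrite ea = s≤s (count-≥1 (λ i → f (suc i)) b eb)
count-≥2 f {suc a} {zero}  ea eb _   rewrite eb = s≤s (count-≥1 (λ i → f (suc i)) a ea)
count-≥2 f {suc a} {suc b} ea eb a≢b =
  ≤-trans (count-≥2 (λ i → f (suc i)) ea eb (λ a≡b → a≢b (cong suc a≡b))) (m≤n+m _ _)

anyFin-intro : ∀ {n} (f : Fin n → Bool) (w : Fin n) → f w ≡ true → anyFin f ≡ true
anyFin-intro f zero    e = ∨-trueˡ e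
anyFin-intro f (suc w) e = ∨-trueʳ (f zero) (anyFin-intro (λ i → f (suc i)) w e)

anyFin-elim : ∀ {n} (f : Fin n → Bool) → anyFin f ≡ true → ∃ λ w → f w ≡ true
anyFin-elim {suc n} f e with ∨-true⇒⊎ (f zero) e
... | inj₁ p = zero , p
... | inj₂ p with anyFin-elim (λ i → f (suc i)) p
...   | w , q = suc w , q

anyUpTo-intro : ∀ (p : ℕ → Bool) {N k} → k ≤ N → p k ≡ true → anyUpTo N p ≡ true
anyUpTo-intro p {zero}  z≤n e = e
anyUpTo-intro p {suc N} k≤N e with m≤n⇒m<n∨m≡n k≤N
... | inj₁ (s≤s k≤N-1) = ∨-trueˡ (anyUpTo-intro p k≤N-1 e)
... | inj₂ refl        = ∨-trueʳ (anyUpTo N p) e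

anyUpTo-elim : ∀ (p : ℕ → Bool) N → anyUpTo N p ≡ true → ∃ λ k → p k ≡ true
anyUpTo-elim p zero    e = zero , e
anyUpTo-elim p (suc N) e with ∨-true⇒⊎ (anyUpTo N p) e
... | inj₁ q = anyUpTo-elim p N q
... | inj₂ q = suc N , q

module _ {n : ℕ} (G : Graph n) where

  within-refl : ∀ k u → within G k u u ≡ true
  within-refl zero    u = isYes-≟-refl u
  within-refl (suc k) u = ∨-trueˡ (within-refl k u)

  within-zero⇒≡ : ∀ {u v} → within G 0 u v ≡ true → u ≡ v
  within-zero⇒≡ {u} {v} = isYes-≟⇒≡ u v

  adj⇒within-one : ∀ {u v} → adj G u v ≡ true → within G 1 u v ≡ true
  adj⇒within-one {u} {v} a =
    ∨-trueʳ (isYes (u ≟ v)) (anyFin-intro _ u (×⇒∧-true (isYes-≟-refl u) a))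

  within-one⇒within-suc : ∀ {u v} → within G 1 u v ≡ true → ∀ k → within G (suc k) u v ≡ true
  within-one⇒within-suc w zero    = w
  within-one⇒within-suc w (suc k) = ∨-trueˡ (within-one⇒within-suc w k)

  nonadjacent⇒¬within-one : ∀ {u v} → u ≢ v → adj G u v ≡ false → within G 1 u v ≡ false
  nonadjacent⇒¬within-one {u} {v} u≢v ¬a rewrite isYes-≟-≢ u≢v = ¬-not λ viaNeighbour →
    let (w , q)   = anyFin-elim _ viaNeighbour
        (u≟w , a) = ∧-true⇒× (isYes (u ≟ w)) q
    in not-¬ ¬a (subst (λ w → adj G w v ≡ true) (sym (isYes-≟⇒≡ u w u≟w)) a)

  closer-intro : ∀ {k u x y} → k ≤ n → within G k u x ≡ true → within G k u y ≡ false →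
                 closer G u x y ≡ true
  closer-intro k≤n wx ¬wy = anyUpTo-intro _ k≤n (×⇒∧-true wx (cong not ¬wy))

  closer-elim : ∀ {u x y} → closer G u x y ≡ true →
                ∃ λ k → within G k u x ≡ true × within G k u y ≡ false
  closer-elim {u} {x} {y} e with anyUpTo-elim _ n e
  ... | k , q with ∧-true⇒× (within G k u x) q
  ...   | wx , ¬wy = k , wx , not-true⇒false ¬wy

  adj⇒≢ : ∀ {u v} → adj G u v ≡ true → u ≢ v
  adj⇒≢ {u} a refl = not-¬ (adj-irr G u) a

  closer-self : ∀ {x y} → x ≢ y → closer G x x y ≡ true
  closer-self x≢y = closer-intro z≤n (within-refl 0 _) (isYes-≟-≢ x≢y)

  closer-via-nonneighbour : ∀ {u x y} → adj G u x ≡ true → u ≢ y → adj G u y ≡ false →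
                            closer G u x y ≡ true
  closer-via-nonneighbour {u} a u≢y ¬a =
    closer-intro (≤-trans (s≤s z≤n) (toℕ<n u)) (adj⇒within-one a) (nonadjacent⇒¬within-one u≢y ¬a)

Dominating : ∀ {n} → Graph n → Fin n → Set
Dominating G c = ∀ u → u ≢ c → adj G u c ≡ true

module _ {n : ℕ} {G : Graph n} {c : Fin n} (dom : Dominating G c) where

  -- Splitting on toSum (u ≟ c) rather than u ≟ c keeps the `u ≟ c` inside `within` intact.
  dominating⇒within-one : ∀ u → within G 1 u c ≡ true
  dominating⇒within-one u with toSum (u ≟ c)
  ... | inj₁ refl = within-refl G 1 u
  ... | inj₂ u≢c  = adj⇒within-one G (dom u u≢c)

  -- Every vertex is within distance 1 of c, so only x itself is strictly closer to x.
  closer-than-dominating⇒≡ : ∀ {u x} → closer G u x c ≡ true → u ≡ x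
  closer-than-dominating⇒≡ {u} e with closer-elim G e
  ... | zero  , wx , _   = within-zero⇒≡ G wx
  ... | suc k , _  , ¬wc = ⊥-elim (not-¬ ¬wc (within-one⇒within-suc G (dominating⇒within-one u) k))

  W-dominating≤1 : ∀ x → W G x c ≤ 1
  W-dominating≤1 x = count-≤1 _ x (λ u → closer-than-dominating⇒≡)

  dominating-adjˡ : ∀ v → v ≢ c → adj G c v ≡ true
  dominating-adjˡ v v≢c = trans (adj-sym G c v) (dom v v≢c)

  -- W_{cv} contains c and the non-neighbour u of v, while |W_{vc}| ≤ 1.
  nonadjacent⇒W-unbalanced : ∀ {u v} → u ≢ c → v ≢ c → u ≢ v → adj G u v ≡ false →
                             W G c v > W G v c
  nonadjacent⇒W-unbalanced {u} {v} u≢c v≢c u≢v ¬uv = ≤-trans (s≤s (W-dominating≤1 v)) W-cv≥2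
    where
    W-cv≥2 : 2 ≤ W G c v
    W-cv≥2 = count-≥2 (λ w → closer G w c v)
      (closer-self G (≢-sym v≢c))
      (closer-via-nonneighbour G (dom u u≢c) u≢v ¬uv)
      (≢-sym u≢c)

  distanceBalanced-dominating⇒adj : DistanceBalanced G → ∀ u v → u ≢ v → adj G u v ≡ true
  distanceBalanced-dominating⇒adj db u v u≢v with u ≟ c | v ≟ c
  ... | yes refl | _        = dominating-adjˡ v (≢-sym u≢v)
  ... | no  _    | yes refl = dom u u≢v
  ... | no  u≢c  | no  v≢c  = ¬-not λ ¬uv →
    >⇒≢ (nonadjacent⇒W-unbalanced u≢c v≢c u≢v ¬uv) (db c v (dominating-adjˡ v v≢c))

adj-complete : ∀ {n} {u v : Fin n} → u ≢ v → adj (complete n) u v ≡ true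
adj-complete u≢v = cong not (isYes-≟-≢ u≢v)

allAdjacent⇒≗complete : ∀ {n} (G : Graph n) → (∀ u v → u ≢ v → adj G u v ≡ true) →
                        ∀ u v → adj G u v ≡ adj (complete n) u v
allAdjacent⇒≗complete G all u v with u ≟ v
... | yes refl = adj-irr G u
... | no  u≢v  = all u v u≢v

complete-distanceBalanced : ∀ n → DistanceBalanced (complete n)
complete-distanceBalanced n x y a = trans (W≡1 x y a) (sym (W≡1 y x (trans (adj-sym K y x) a)))
  where
  K = complete n
  W≡1 : ∀ x y → adj K x y ≡ true → W K x y ≡ 1
  W≡1 x y a = ≤-antisym (W-dominating≤1 (λ u → adj-complete) x)
                        (count-≥1 _ x (closer-self K (adj⇒≢ K a)))

starSupergraph-dominating : ∀ {m} {G : Graph (suc m)} → star m ⊆G G → Dominating G zero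
starSupergraph-dominating s zero    0≢0 = ⊥-elim (0≢0 refl)
starSupergraph-dominating s (suc u) _   = s (suc u) zero refl

distanceBalanced-starSupergraph⇒≗complete :
  ∀ {m} (G : Graph (suc m)) → DistanceBalanced G → star m ⊆G G →
  ∀ u v → adj G u v ≡ adj (complete (suc m)) u v
distanceBalanced-starSupergraph⇒≗complete G db s =
  allAdjacent⇒≗complete G (distanceBalanced-dominating⇒adj (starSupergraph-dominating {G = G} s) db)

star⊆complete : ∀ m → star m ⊆G complete (suc m)
star⊆complete m zero    (suc j) _ = refl
star⊆complete m (suc i) zero    _ = refl

edges-cong : ∀ {n} {G H : Graph n} → (∀ i j → adj G i j ≡ adj H i j) → edges G ≡ edges H
edges-cong {n} e = sumFin-cong {n} (λ i → count-cong {n} (λ j → cong (_∧ _) (e i j)))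

edges-star : ∀ m → edges (star m) ≡ m
edges-star m = trans (cong₂ _+_ centreDegree leavesContributeNothing) (+-identityʳ m)
  where
  edgeUpwards : Fin (suc m) → Fin (suc m) → Bool
  edgeUpwards i j = adj (star m) i j ∧ (toℕ i <ᵇ toℕ j)
  centreDegree : count (edgeUpwards zero) ≡ m
  centreDegree = count-const-true (λ j → edgeUpwards zero (suc j)) (λ _ → refl)
  leavesContributeNothing : sumFin (λ i → count (edgeUpwards (suc i))) ≡ 0
  leavesContributeNothing =
    sumFin-const-zero (λ i → count-const-false (edgeUpwards (suc i)) (λ { zero → refl ; (suc _) → refl }))

edges-complete-suc : ∀ n → edges (complete (suc n)) ≡ n + edges (complete n)
edges-complete-suc n = cong₂ _+_ (count-const-true {n} _ (λ _ → refl))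
  (sumFin-cong {n} (λ i → count-cong {n} (λ j → cong (λ b → not b ∧ (toℕ i <ᵇ toℕ j)) (isYes-suc-≟-suc i j))))

edges-complete : ∀ n → edges (complete n) ≡ n C 2
edges-complete zero    = refl
edges-complete (suc n) = begin
  edges (complete (suc n))   ≡⟨ edges-complete-suc n ⟩
  n + edges (complete n)     ≡⟨ cong₂ _+_ (sym (nC1≡n n)) (edges-complete n) ⟩
  n C 1 + n C 2              ≡⟨ nCk+nC[k+1]≡[n+1]C[k+1] n 1 ⟩
  suc n C 2                  ∎
  where open ≡-Reasoning

edges-complete≡edges-star+missing : ∀ m →
  edges (complete (suc m)) ≡ edges (star m) + (suc m C 2 ∸ m)
edges-complete≡edges-star+missing m = begin
  edges (complete (suc m))                     ≡⟨ edges-complete-suc m ⟩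
  m + edges (complete m)                       ≡⟨ cong (m +_) (sym (m+n∸m≡n m _)) ⟩
  m + (m + edges (complete m) ∸ m)             ≡⟨ cong (λ e → m + (e ∸ m)) (sym (edges-complete-suc m)) ⟩
  m + (edges (complete (suc m)) ∸ m)           ≡⟨ cong₂ (λ a e → a + (e ∸ m)) (sym (edges-star m)) (edges-complete (suc m)) ⟩
  edges (star m) + (suc m C 2 ∸ m)             ∎
  where open ≡-Reasoning

corollary2p2 : (m : ℕ) → 1 ≤ m →
    IsB (star m) ((suc m C 2) ∸ m)
    × IsDBClosure (star m) (complete (suc m))
    × (∀ G → IsDBClosure (star m) G → G ≅ complete (suc m))
corollary2p2 m _ = isB , (complete-distanceBalanced (suc m) , star⊆complete m , closure) , unique
  where
  K = complete (suc m)
  edges-K : edges K ≡ edges (star m) + (suc m C 2 ∸ m)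
  edges-K = edges-complete≡edges-star+missing m

  forced : ∀ G → DistanceBalanced G → star m ⊆G G → edges G ≡ edges K
  forced G db s = edges-cong {G = G} {H = K} (distanceBalanced-starSupergraph⇒≗complete G db s)

  isB : IsB (star m) ((suc m C 2) ∸ m)
  isB = (K , complete-distanceBalanced (suc m) , star⊆complete m , edges-K)
      , λ G db s → ≤-reflexive (trans (sym edges-K) (sym (forced G db s)))

  closure : ∀ k → IsB (star m) k → edges K ≡ edges (star m) + k
  closure k ((G , db , s , e) , _) = trans (sym (forced G db s)) e

  unique : ∀ G → IsDBClosure (star m) G → G ≅ K
  unique G (db , s , _) = ↔-refl , distanceBalanced-starSupergraph⇒≗complete G db s
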